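{- Let $t\ge 2$ be an integer. Every subgraph of a $t$-pg graph is also a $t$-pg graph.
   Context: Let $V$ be a finite vertex set and $t\ge 2$ an integer. A sequence of edge sets $(E_1,\dots,E_k)$ on $V$ is $t$-pg if for each $i\in[k]$: $E_i$ is a matching on $V$, and $d_{G_{i-1}}(u,v)>t$ for every $\{u,v\}\in E_i$, where $G_{i-1}$ is the graph on $V$ with edge set $\bigcup_{j\le i-1}E_j$ and $d$ denotes hop distance (infinite between disconnected vertices). A graph $G=(V,E)$ is $t$-pg if $E$ is the union of some $t$-pg sequence on $V$. -}

module Defs where

open import Data.Nat using (ℕ; zero; suc; _≤_; _<_)
open import Data.Fin using (Fin; toℕ)
open import Data.Product using (Σ; ∃; _×_)
open import Relation.Nullary using (¬_)
open import Relation.Binary.PropositionalEquality using (_≡_)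
open import Function.Bundles using (_⇔_)

-- An edge set on the vertex set V = Fin n, as a relation: E u v means {u,v} ∈ E.
EdgeSet : ℕ → Set₁
EdgeSet n = Fin n → Fin n → Set

Symmetric : ∀ {n} → EdgeSet n → Set
Symmetric E = ∀ u v → E u v → E v u

IsGraph : ∀ {n} → EdgeSet n → Set
IsGraph E = Symmetric E × (∀ u → ¬ E u u)

IsMatching : ∀ {n} → EdgeSet n → Set
IsMatching M = IsGraph M × (∀ u v w → M u v → M u w → v ≡ w)

data Walk {n} (E : EdgeSet n) : ℕ → Fin n → Fin n → Set where
  nil  : ∀ {u} → Walk E zero u u
  cons : ∀ {l u w v} → E u w → Walk E l w v → Walk E (suc l) u v

-- Hop distance d_E(u,v) > t (infinite distance allowed): no walk of length ≤ t.
DistGt : ∀ {n} → EdgeSet n → ℕ → Fin n → Fin n → Set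
DistGt E t u v = ∀ l → l ≤ t → ¬ Walk E l u v

-- G_{i-1}: union of the edge sets E_j with j < i.
Prefix : ∀ {n k} → (Fin k → EdgeSet n) → Fin k → EdgeSet n
Prefix Es i u v = ∃ λ j → toℕ j < toℕ i × Es j u v

IsTpgSeq : ∀ {n k} → ℕ → (Fin k → EdgeSet n) → Set
IsTpgSeq t Es = ∀ i → IsMatching (Es i) × (∀ u v → Es i u v → DistGt (Prefix Es i) t u v)

IsTpg : ∀ {n} → ℕ → EdgeSet n → Set₁
IsTpg {n} t E = Σ ℕ λ k → Σ (Fin k → EdgeSet n) λ Es →
  IsTpgSeq t Es × (∀ u v → E u v ⇔ ∃ λ j → Es j u v)

{-# OPTIONS --safe #-}
module Submission where

open import Defs
open import Data.Nat using (ℕ; _≤_)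
open import Data.Fin using (Fin)
open import Data.Product using (∃; _×_; _,_; proj₁; proj₂)
open import Function.Bundles using (_⇔_; mk⇔; Equivalence)
open import Function.Definitions using (Injective)
open import Relation.Binary.PropositionalEquality using (_≡_)

-- Restrict every matching of a t-pg sequence for G to the edges of H (pulled back
-- along the embedding f). Matchings stay matchings since f is injective, and the
-- distance conditions survive because walks in a restricted prefix map to walks in
-- the original prefix, so distances can only grow.

infix  4 _⊆_
infixr 6 _∩_
infix  8 _⁻¹[_]

_⊆_ : ∀ {n} → EdgeSet n → EdgeSet n → Set
A ⊆ B = ∀ u v → A u v → B u v

_∩_ : ∀ {n} → EdgeSet n → EdgeSet n → EdgeSet n
(A ∩ B) u v = A u v × B u v

_⁻¹[_] : ∀ {m n} → EdgeSet n → (Fin m → Fin n) → EdgeSet m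
(E ⁻¹[ f ]) u v = E (f u) (f v)

Walk-map : ∀ {m n} {A : EdgeSet m} {B : EdgeSet n} (f : Fin m → Fin n) →
           A ⊆ B ⁻¹[ f ] → ∀ {l u v} → Walk A l u v → Walk B l (f u) (f v)
Walk-map f A⊆B nil                         = nil
Walk-map f A⊆B (cons {u = u} {w = w} e ws) = cons (A⊆B u w e) (Walk-map f A⊆B ws)

DistGt-pullback : ∀ {m n t} {A : EdgeSet m} {B : EdgeSet n} (f : Fin m → Fin n) →
                  A ⊆ B ⁻¹[ f ] → ∀ {u v} → DistGt B t (f u) (f v) → DistGt A t u v
DistGt-pullback f A⊆B far l l≤t ws = far l l≤t (Walk-map f A⊆B ws)

IsMatching-restrict : ∀ {m n} {H : EdgeSet m} {M : EdgeSet n} {f : Fin m → Fin n} →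
                      Symmetric H → Injective _≡_ _≡_ f → IsMatching M →
                      IsMatching (H ∩ M ⁻¹[ f ])
IsMatching-restrict {f = f} symH inj ((symM , looplessM) , uniqueM) =
  ( (λ u v (h , e) → symH u v h , symM (f u) (f v) e)
  , λ u (_ , e) → looplessM (f u) e )
  , λ u v w (_ , e₁) (_ , e₂) → inj (uniqueM (f u) (f v) (f w) e₁ e₂)

Prefix-restrict : ∀ {m n k} (H : EdgeSet m) (Es : Fin k → EdgeSet n)
                  (f : Fin m → Fin n) (i : Fin k) →
                  Prefix (λ j → H ∩ Es j ⁻¹[ f ]) i ⊆ Prefix Es i ⁻¹[ f ]
Prefix-restrict H Es f i u v (j , j<i , _ , e) = j , j<i , e

IsTpgSeq-restrict : ∀ {m n k t} {H : EdgeSet m} {Es : Fin k → EdgeSet n}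
                    {f : Fin m → Fin n} → Symmetric H → Injective _≡_ _≡_ f →
                    IsTpgSeq t Es → IsTpgSeq t (λ j → H ∩ Es j ⁻¹[ f ])
IsTpgSeq-restrict {H = H} {Es} {f} symH inj tpg i =
    IsMatching-restrict symH inj (proj₁ (tpg i))
  , λ u v (_ , e) → DistGt-pullback f (Prefix-restrict H Es f i)
                      (proj₂ (tpg i) (f u) (f v) e)

IsTpg-embedding : ∀ {m n t} {G : EdgeSet n} {H : EdgeSet m} (f : Fin m → Fin n) →
                  Symmetric H → Injective _≡_ _≡_ f → H ⊆ G ⁻¹[ f ] →
                  IsTpg t G → IsTpg t H
IsTpg-embedding {H = H} f symH inj H⊆G (k , Es , tpg , G⇔⋃Es) =
  k , (λ j → H ∩ Es j ⁻¹[ f ]) , IsTpgSeq-restrict symH inj tpg , H⇔⋃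
  where
  H⇔⋃ : ∀ u v → H u v ⇔ ∃ λ j → (H ∩ Es j ⁻¹[ f ]) u v
  H⇔⋃ u v = mk⇔
    (λ h → let j , e = Equivalence.to (G⇔⋃Es (f u) (f v)) (H⊆G u v h) in j , h , e)
    (λ (_ , h , _) → h)

lemma4p7 : (t : ℕ) → 2 ≤ t →
    (n : ℕ) (G : EdgeSet n) → IsGraph G → IsTpg t G →
    (m : ℕ) (H : EdgeSet m) → IsGraph H →
    (f : Fin m → Fin n) → Injective _≡_ _≡_ f →
    (∀ u v → H u v → G (f u) (f v)) →
    IsTpg t H
lemma4p7 _ _ _ _ _ tpgG _ _ (symH , _) f inj H⊆G =
  IsTpg-embedding f symH inj H⊆G tpgG
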